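{- Let $\lambda\neq 0$ be a constant and define numbers $a_j(N)=a_j(N;\lambda)$ for integers $N\ge 0$, $j\ge 0$ by $a_0(0)=\frac{1}{\lambda}$, $a_j(0)=0$ for $j\ge 1$, and for $N\ge 0$: $$a_0(N+1)=(N+\lambda)\,a_0(N),\qquad a_j(N+1)=(N+(j+1)\lambda)\,a_j(N)+j\lambda\, a_{j-1}(N)\quad (j\ge 1).$$ (In particular $a_j(N)=0$ for $j\ge N+1$.) Then for every $N\ge 1$ and every $j=1,2,\ldots,N$, $$a_j(N)=j\lambda\sum_{i=0}^{N-j}(N+(j+1)\lambda-1)_i\,a_{j-1}(N-i-1).$$
   Context: $(x)_n$ denotes the falling factorial $x(x-1)\cdots(x-n+1)$, with $(x)_0=1$. The numbers $a_j(N)$ are exactly the coefficients for which the function $F(t)=\frac{1}{(1+t)^\lambda-1}$ satisfies $F^{(N)}=\frac{(-1)^N\lambda}{(1+t)^N}\sum_{i=1}^{N+1}a_{i-1}(N)F^i$. -}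

module Defs where

open import Level using (Level)
open import Data.Nat as ℕ using (ℕ; zero; suc; _∸_)
open import Algebra.Bundles using (CommutativeRing)

module _ {c ℓ : Level} (R : CommutativeRing c ℓ) where
  open CommutativeRing R hiding (zero)

  ι : ℕ → Carrier
  ι zero    = 0#
  ι (suc n) = 1# + ι n

  falling : Carrier → ℕ → Carrier
  falling x zero    = 1#
  falling x (suc n) = falling x n * (x - ι n)

  Σ< : ℕ → (ℕ → Carrier) → Carrier
  Σ< zero    f = 0#
  Σ< (suc n) f = Σ< n f + f n

  -- a j N = a_j(N; λ), where lam = λ and laminv = λ⁻¹
  a : (lam laminv : Carrier) → ℕ → ℕ → Carrier
  a lam laminv zero    zero    = laminv
  a lam laminv (suc j) zero    = 0#
  a lam laminv zero    (suc N) = (ι N + lam) * a lam laminv zero N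
  a lam laminv (suc j) (suc N) =
    (ι N + ι (suc (suc j)) * lam) * a lam laminv (suc j) N
      + (ι (suc j) * lam) * a lam laminv j N

-- Unrolling a recurrence
-- u(n+1) = (n + γ) u(n) + v(n) produces products of consecutive coefficients
-- (n + γ - 1)(n + γ - 2)⋯, i.e. falling factorials of n + γ - 1. Starting the
-- unrolling at N = j - 1, where a_j vanishes, leaves only the sum.
module Submission where

open import Defs
open import Level using (Level)
open import Data.Nat as ℕ using (ℕ; zero; suc; _∸_; _≤_; _<_; s≤s)
import Data.Nat.Properties as ℕ
open import Algebra.Bundles using (CommutativeRing)
import Algebra.Properties.AbelianGroup as AbelianGroupProperties
import Algebra.Properties.CommutativeSemigroup as CommutativeSemigroupProperties
open import Relation.Binary.PropositionalEquality as ≡ using (_≡_)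
import Relation.Binary.Reasoning.Setoid as SetoidReasoning

module _ {c ℓ : Level} (R : CommutativeRing c ℓ) where
  open CommutativeRing R hiding (zero)
  open SetoidReasoning setoid
  open AbelianGroupProperties +-abelianGroup using (⁻¹-∙-comm)
  open CommutativeSemigroupProperties *-commutativeSemigroup using (x∙yz≈y∙xz)

  -0#≈0# : - 0# ≈ 0#
  -0#≈0# = begin
    - 0#       ≈⟨ sym (+-identityˡ _) ⟩
    0# + - 0#  ≈⟨ -‿inverseʳ 0# ⟩
    0#         ∎

  1#+x+y-1#≈x+y : ∀ x y → 1# + x + y - 1# ≈ x + y
  1#+x+y-1#≈x+y x y = begin
    1# + x + y - 1#        ≈⟨ +-congʳ (+-assoc 1# x y) ⟩
    1# + (x + y) - 1#      ≈⟨ +-comm _ _ ⟩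
    - 1# + (1# + (x + y))  ≈⟨ sym (+-assoc _ _ _) ⟩
    - 1# + 1# + (x + y)    ≈⟨ +-congʳ (-‿inverseˡ 1#) ⟩
    0# + (x + y)           ≈⟨ +-identityˡ _ ⟩
    x + y                  ∎

  x[y+zw]+v≈v+xy+xz*w : ∀ x y z w v → x * (y + z * w) + v ≈ v + x * y + x * z * w
  x[y+zw]+v≈v+xy+xz*w x y z w v = begin
    x * (y + z * w) + v          ≈⟨ +-congʳ (distribˡ x y (z * w)) ⟩
    x * y + x * (z * w) + v      ≈⟨ +-assoc _ _ _ ⟩
    x * y + (x * (z * w) + v)    ≈⟨ +-congˡ (+-comm _ _) ⟩
    x * y + (v + x * (z * w))    ≈⟨ sym (+-assoc _ _ _) ⟩
    x * y + v + x * (z * w)      ≈⟨ +-cong (+-comm _ _) (sym (*-assoc x z w)) ⟩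
    v + x * y + x * z * w        ∎

  falling-cong : ∀ {x y} n → x ≈ y → falling R x n ≈ falling R y n
  falling-cong zero    x≈y = refl
  falling-cong (suc n) x≈y = *-cong (falling-cong n x≈y) (+-congʳ x≈y)

  falling-suc : ∀ x n → falling R x (suc n) ≈ x * falling R (x - 1#) n
  falling-suc x zero = begin
    1# * (x - 0#)  ≈⟨ *-identityˡ _ ⟩
    x - 0#         ≈⟨ +-congˡ -0#≈0# ⟩
    x + 0#         ≈⟨ +-identityʳ x ⟩
    x              ≈⟨ sym (*-identityʳ x) ⟩
    x * 1#         ∎
  falling-suc x (suc n) = begin
    falling R x (suc n) * (x - (1# + ι R n))
      ≈⟨ *-cong (falling-suc x n) (+-congˡ (sym (⁻¹-∙-comm 1# (ι R n)))) ⟩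
    x * falling R (x - 1#) n * (x + (- 1# + - ι R n))
      ≈⟨ *-congˡ (sym (+-assoc x (- 1#) (- ι R n))) ⟩
    x * falling R (x - 1#) n * (x - 1# - ι R n)
      ≈⟨ *-assoc _ _ _ ⟩
    x * falling R (x - 1#) (suc n)
      ∎

  Σ<-cong : ∀ n {f g : ℕ → Carrier} → (∀ i → f i ≈ g i) → Σ< R n f ≈ Σ< R n g
  Σ<-cong zero    f≈g = refl
  Σ<-cong (suc n) f≈g = +-cong (Σ<-cong n f≈g) (f≈g n)

  Σ<-*-distribˡ : ∀ n x (f : ℕ → Carrier) → x * Σ< R n f ≈ Σ< R n (λ i → x * f i)
  Σ<-*-distribˡ zero    x f = zeroʳ x
  Σ<-*-distribˡ (suc n) x f = begin
    x * (Σ< R n f + f n)      ≈⟨ distribˡ x _ _ ⟩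
    x * Σ< R n f + x * f n    ≈⟨ +-congʳ (Σ<-*-distribˡ n x f) ⟩
    Σ< R (suc n) (λ i → x * f i) ∎

  Σ<-suc : ∀ n (f : ℕ → Carrier) → Σ< R (suc n) f ≈ f 0 + Σ< R n (λ i → f (suc i))
  Σ<-suc zero    f = trans (+-identityˡ _) (sym (+-identityʳ _))
  Σ<-suc (suc n) f = begin
    Σ< R (suc n) f + f (suc n)                    ≈⟨ +-congʳ (Σ<-suc n f) ⟩
    f 0 + Σ< R n (λ i → f (suc i)) + f (suc n)    ≈⟨ +-assoc _ _ _ ⟩
    f 0 + Σ< R (suc n) (λ i → f (suc i))          ∎

  unroll-linear-recurrence :
    (γ : Carrier) (u v : ℕ → Carrier) →
    (∀ n → u (suc n) ≈ (ι R n + γ) * u n + v n) →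
    ∀ m k {n} → m ℕ.+ k ≡ n →
    u n ≈ Σ< R m (λ i → falling R (ι R n + γ - 1#) i * v (n ∸ i ∸ 1))
          + falling R (ι R n + γ - 1#) m * u k
  unroll-linear-recurrence γ u v step zero k ≡.refl = begin
    u k            ≈⟨ sym (*-identityˡ (u k)) ⟩
    1# * u k       ≈⟨ sym (+-identityˡ _) ⟩
    0# + 1# * u k  ∎
  unroll-linear-recurrence γ u v step (suc m) k ≡.refl = begin
    u (suc n)                           ≈⟨ step n ⟩
    y * u n + v n                       ≈⟨ +-congʳ (*-congˡ (unroll-linear-recurrence γ u v step m k ≡.refl)) ⟩
    y * (S + F * u k) + v n             ≈⟨ x[y+zw]+v≈v+xy+xz*w y S F (u k) (v n) ⟩
    v n + y * S + y * F * u k           ≈⟨ +-cong (sym Σ-step) (*-congʳ (sym (falling-step m))) ⟩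
    Σ< R (suc m) f + falling R x (suc m) * u k ∎
    where
    n : ℕ
    n = m ℕ.+ k
    y x : Carrier
    y = ι R n + γ
    x = ι R (suc n) + γ - 1#
    f g : ℕ → Carrier
    f i = falling R x i * v (suc n ∸ i ∸ 1)
    g i = falling R (y - 1#) i * v (n ∸ i ∸ 1)
    S F : Carrier
    S = Σ< R m g
    F = falling R (y - 1#) m

    falling-step : ∀ i → falling R x (suc i) ≈ y * falling R (y - 1#) i
    falling-step i = trans (falling-suc x i)
      (*-cong (1#+x+y-1#≈x+y (ι R n) γ) (falling-cong i (+-congʳ (1#+x+y-1#≈x+y (ι R n) γ))))

    Σ-step : Σ< R (suc m) f ≈ v n + y * S
    Σ-step = begin
      Σ< R (suc m) f                   ≈⟨ Σ<-suc m f ⟩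
      f 0 + Σ< R m (λ i → f (suc i))   ≈⟨ +-cong (*-identityˡ _) (Σ<-cong m λ i → trans (*-congʳ (falling-step i)) (*-assoc _ _ _)) ⟩
      v n + Σ< R m (λ i → y * g i)     ≈⟨ +-congˡ (sym (Σ<-*-distribˡ m y g)) ⟩
      v n + y * S                      ∎

  a-vanishes : ∀ lam laminv {j n} → n < j → a R lam laminv j n ≈ 0#
  a-vanishes lam laminv {suc j} {zero}  _         = refl
  a-vanishes lam laminv {suc j} {suc n} (s≤s n<j) = begin
    _ * a R lam laminv (suc j) n + _ * a R lam laminv j n
      ≈⟨ +-cong (*-congˡ (a-vanishes lam laminv (ℕ.m<n⇒m<1+n n<j))) (*-congˡ (a-vanishes lam laminv n<j)) ⟩
    _ * 0# + _ * 0#  ≈⟨ +-cong (zeroʳ _) (zeroʳ _) ⟩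
    0# + 0#          ≈⟨ +-identityʳ _ ⟩
    0#               ∎

lemma1 : {c ℓ : Level} (R : CommutativeRing c ℓ) →
         let open CommutativeRing R in
         (lam laminv : Carrier) → lam * laminv ≈ 1# →
         (N j : ℕ) → 1 ≤ j → j ≤ N →
         a R lam laminv j N
           ≈ (ι R j * lam)
             * Σ< R (suc (N ∸ j))
                 (λ i → falling R ((ι R N + ι R (suc j) * lam) - 1#) i
                        * a R lam laminv (j ∸ 1) (N ∸ i ∸ 1))
lemma1 R lam laminv _ N (suc k) _ k<N = begin
  a′ (suc k) N
    ≈⟨ unroll-linear-recurrence R γ (a′ (suc k)) (λ n → L * a′ k n) (λ _ → refl) m k m+k≡N ⟩
  Σ< R m (λ i → falling R x i * (L * a′ k (N ∸ i ∸ 1))) + falling R x m * a′ (suc k) k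
    ≈⟨ +-congˡ (trans (*-congˡ (a-vanishes R lam laminv (ℕ.n<1+n k))) (zeroʳ _)) ⟩
  Σ< R m (λ i → falling R x i * (L * a′ k (N ∸ i ∸ 1))) + 0#
    ≈⟨ +-identityʳ _ ⟩
  Σ< R m (λ i → falling R x i * (L * a′ k (N ∸ i ∸ 1)))
    ≈⟨ Σ<-cong R m (λ i → x∙yz≈y∙xz _ _ _) ⟩
  Σ< R m (λ i → L * (falling R x i * a′ k (N ∸ i ∸ 1)))
    ≈⟨ sym (Σ<-*-distribˡ R m L _) ⟩
  L * Σ< R m (λ i → falling R x i * a′ k (N ∸ i ∸ 1)) ∎
  where
  open CommutativeRing R
  open SetoidReasoning setoid
  open CommutativeSemigroupProperties *-commutativeSemigroup using (x∙yz≈y∙xz)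
  a′ : ℕ → ℕ → Carrier
  a′ = a R lam laminv
  γ L x : Carrier
  γ = ι R (suc (suc k)) * lam
  L = ι R (suc k) * lam
  x = ι R N + γ - 1#
  m : ℕ
  m = suc (N ∸ suc k)
  m+k≡N : m ℕ.+ k ≡ N
  m+k≡N = ≡.trans (≡.cong suc (ℕ.+-comm (N ∸ suc k) k)) (ℕ.m+[n∸m]≡n k<N)
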